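{- Let $G$ be a ribbon graph, $T$ a spanning tree of $G$, $e\in E(T)$, and $E_e$ the adjoint set of $e$ with respect to $T$. If $G$ is checkerboard colourable, then the partial Petrial $G^{\tau(E_e)}$ is checkerboard colourable.
   Context: A ribbon graph is a (possibly non-orientable) surface with boundary written as a union of vertex discs and edge discs meeting in disjoint line segments (common line segments), each lying on exactly one vertex and one edge, each edge containing exactly two. Edge line segments: the two boundary arcs of an edge disc other than its common line segments. $G$ is checkerboard colourable if its boundary components can be coloured with two colours so that the two edge line segments of each edge receive different colours. Arrow presentation: circles (vertex boundaries) with, for each edge $f$, two marking arrows labelled $f$; the ribbon graph is recovered by filling circles with discs and attaching an edge disc along the two $f$-arrows so that their directions agree. Partial Petrial $G^{\tau(A)}$: reverse one of the two arrows of each edge of $A$. Partial dual $G^{\delta(A)}$: for $f\in A$ with arrows $f',f''$, draw segments directed from the head of $f'$ to the tail of $f''$ and from the head of $f''$ to the tail of $f'$, both labelled $f$, and delete the arcs carrying $f',f''$. For a spanning tree $T$, $G^{\delta(E(T))}$ is a bouquet, whose arrow presentation is a single circle carrying the marking arrows of all edges of $G$. Adjoint set: for $e\in E(T)$, the two marking arrows of $e$ cut this circle into two arcs; choose one of them, $P_e$. Then $E_e=\{e\}\cup\{f\in E(G)\setminus E(T)\mid \text{exactly one of the two marking arrows of } f \text{ lies on } P_e\}$ (this does not depend on the choice of arc). -}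

module Defs where

open import Data.Nat using (ℕ)
open import Data.Fin using (Fin; zero; suc)
open import Data.Bool using (Bool; true; false; not)
open import Data.Bool.Properties using (not-involutive)
open import Data.Product using (Σ; _×_; _,_; proj₁)
open import Data.Sum using (_⊎_)
open import Relation.Binary.PropositionalEquality
open import Relation.Nullary using (¬_)
open import Relation.Binary.Construct.Closure.Equivalence using (EqClosure)

-- A ribbon graph with edge set E = Fin m is given by an arrow presentation.
-- Each edge f has two marking arrows f' (index zero) and f'' (index suc zero);
-- each arrow has a tail end (false) and a head end (true).  Every vertex circle is cut by the arrow ends into
-- alternating arcs: arcs carrying a marking arrow (joining the two ends of
-- the same arrow) and "gaps" (arcs of the circle between consecutive
-- arrows).  The gaps form a fixed-point-free involution `gap` on End m, and
-- the vertex circles are exactly the cycles formed by gap-arcs and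
-- arrow-arcs.  (Vertices carrying no arrows are not represented.)

End : ℕ → Set
End m = Fin m × Fin 2 × Bool

record RibbonGraph (m : ℕ) : Set where
  field
    gap       : End m → End m
    gap-invol : ∀ x → gap (gap x) ≡ x
    gap-nofix : ∀ x → gap x ≢ x
open RibbonGraph public

flip2 : Fin 2 → Fin 2
flip2 zero = suc zero
flip2 (suc zero) = zero

-- the other end of the same marking arrow (the arc carrying the arrow)
arrowPartner : ∀ {m} → End m → End m
arrowPartner (f , i , b) = f , i , not b

-- edge line segments: the edge disc of f is glued along f' and f'' with
-- agreeing directions, so one edge line segment joins the heads of f', f''
-- and the other joins their tails.
segPartner : ∀ {m} → End m → End m
segPartner (f , i , b) = f , flip2 i , b

-- Boundary components of G are the cycles made of gap-arcs and edge line
-- segments.  A 2-colouring of boundary components is the same as a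
-- function on arrow ends that is constant along gaps and edge line
-- segments.  The two edge line segments of f contain the head (resp. tail)
-- of f', so they get different colours iff c (f,0,head) ≠ c (f,0,tail).

CheckerboardColourable : ∀ {m} → RibbonGraph m → Set
CheckerboardColourable {m} G =
  Σ (End m → Bool) λ c →
      (∀ x → c (gap G x) ≡ c x)
    × (∀ x → c (segPartner x) ≡ c x)
    × (∀ f → c (f , zero , true) ≢ c (f , zero , false))

-- Partial Petrial: reverse the arrow f' of each f ∈ A (swap head/tail).

petRelabel : ∀ {m} → (Fin m → Bool) → End m → End m
petRelabel A (f , zero , b) with A f
... | true  = f , zero , not b
... | false = f , zero , b
petRelabel A (f , suc zero , b) = f , suc zero , b

petRelabel-invol : ∀ {m} (A : Fin m → Bool) x → petRelabel A (petRelabel A x) ≡ x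
petRelabel-invol A (f , zero , b) with A f in eq
... | true  rewrite eq | not-involutive b = refl
... | false rewrite eq = refl
petRelabel-invol A (f , suc zero , b) = refl

partialPetrial : ∀ {m} → RibbonGraph m → (Fin m → Bool) → RibbonGraph m
partialPetrial G A = record
  { gap       = λ x → ρ (gap G (ρ x))
  ; gap-invol = λ x → trans (cong ρ (trans (cong (gap G) (petRelabel-invol A (gap G (ρ x))))
                                             (gap-invol G (ρ x))))
                            (petRelabel-invol A x)
  ; gap-nofix = λ x eq → gap-nofix G (ρ x)
                  (trans (sym (petRelabel-invol A (gap G (ρ x)))) (cong ρ eq))
  }
  where ρ = petRelabel A

-- For f ∈ A, the new arrow f' runs from the head of the
-- old f' to the tail of the old f'', and the new arrow f'' from the head
-- of the old f'' to the tail of the old f'; the arcs carrying the old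
-- arrows are deleted, the gaps are kept.  `dualOut` sends an old arrow end
-- to its label in the partial dual, `dualIn` is its inverse.

dualOut : ∀ {m} → (Fin m → Bool) → End m → End m
dualOut A (f , i , b) with A f
dualOut A (f , zero     , true ) | true = f , zero , false
dualOut A (f , suc zero , false) | true = f , zero , true
dualOut A (f , suc zero , true ) | true = f , suc zero , false
dualOut A (f , zero     , false) | true = f , suc zero , true
... | false = f , i , b

dualIn : ∀ {m} → (Fin m → Bool) → End m → End m
dualIn A (f , i , b) with A f
dualIn A (f , zero     , false) | true = f , zero , true
dualIn A (f , zero     , true ) | true = f , suc zero , false
dualIn A (f , suc zero , false) | true = f , suc zero , true
dualIn A (f , suc zero , true ) | true = f , zero , false
... | false = f , i , b

dualOutIn : ∀ {m} (A : Fin m → Bool) x → dualOut A (dualIn A x) ≡ x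
dualOutIn A (f , i , b) with A f in eq
dualOutIn A (f , zero     , false) | true rewrite eq = refl
dualOutIn A (f , zero     , true ) | true rewrite eq = refl
dualOutIn A (f , suc zero , false) | true rewrite eq = refl
dualOutIn A (f , suc zero , true ) | true rewrite eq = refl
... | false rewrite eq = refl

dualInOut : ∀ {m} (A : Fin m → Bool) x → dualIn A (dualOut A x) ≡ x
dualInOut A (f , i , b) with A f in eq
dualInOut A (f , zero     , false) | true rewrite eq = refl
dualInOut A (f , zero     , true ) | true rewrite eq = refl
dualInOut A (f , suc zero , false) | true rewrite eq = refl
dualInOut A (f , suc zero , true ) | true rewrite eq = refl
... | false rewrite eq = refl

partialDual : ∀ {m} → RibbonGraph m → (Fin m → Bool) → RibbonGraph m
partialDual G A = record
  { gap       = λ x → dualOut A (gap G (dualIn A x))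
  ; gap-invol = λ x → trans (cong (dualOut A) (trans (cong (gap G) (dualInOut A (gap G (dualIn A x))))
                                                     (gap-invol G (dualIn A x))))
                            (dualOutIn A x)
  ; gap-nofix = λ x eq → gap-nofix G (dualIn A x)
                  (trans (sym (dualInOut A (gap G (dualIn A x)))) (cong (dualIn A) eq))
  }

-- Spanning trees.  Two arrow ends are joined in the spanning subgraph
-- (V(G), S) if one can travel along vertex circles (gaps and arrow arcs)
-- and across edges of S (from arrow f' to arrow f'').

data SubStep {m} (G : RibbonGraph m) (S : Fin m → Set) : End m → End m → Set where
  viaGap   : ∀ x → SubStep G S x (gap G x)
  viaArrow : ∀ x → SubStep G S x (arrowPartner x)
  viaEdge  : ∀ x → S (proj₁ x) → SubStep G S x (segPartner x)

Joined : ∀ {m} → RibbonGraph m → (Fin m → Set) → End m → End m → Set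
Joined G S = EqClosure (SubStep G S)

-- T is a spanning tree: the spanning subgraph with edge set T is connected,
-- and it has no cycle, i.e. no edge f of T has its two ends joined in T - f.
IsSpanningTree : ∀ {m} → RibbonGraph m → (Fin m → Bool) → Set
IsSpanningTree {m} G T =
    (∀ x y → Joined G (λ g → T g ≡ true) x y)
  × (∀ f → T f ≡ true →
       ¬ Joined G (λ g → T g ≡ true × g ≢ f) (f , zero , true) (f , suc zero , true))

-- In D = G^{δ(E(T))} (a single circle), cut out the arcs
-- carrying the two marking arrows of e; the arc P_e is the piece that
-- contains the head of the arrow e'.  Arrow (f,i) lies on P_e iff its
-- head is joined to the head of e' without crossing the arrows of e.

data CutStep {m} (D : RibbonGraph m) (e : Fin m) : End m → End m → Set where
  viaGap   : ∀ x → CutStep D e x (gap D x)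
  viaArrow : ∀ x → proj₁ x ≢ e → CutStep D e x (arrowPartner x)

OnArc : ∀ {m} → RibbonGraph m → (Fin m → Bool) → Fin m → Fin m → Fin 2 → Set
OnArc G T e f i = EqClosure (CutStep (partialDual G T) e) (f , i , true) (e , zero , true)

InAdjointSet : ∀ {m} → RibbonGraph m → (Fin m → Bool) → Fin m → Fin m → Set
InAdjointSet G T e f =
    f ≡ e
  ⊎ (T f ≡ false
     × ((OnArc G T e f zero × ¬ OnArc G T e f (suc zero))
        ⊎ (¬ OnArc G T e f zero × OnArc G T e f (suc zero))))

-- Let side x record whether the arrow end x lies in the component of T - e containing the
-- arrow e' or the one containing e''.  Walking along the circle of the bouquet G^{δ(T)} without
-- crossing the arrows of e never changes the side; conversely, because a partial dual along a
-- forest merges each of its trees into a single vertex circle, every arrow end on the e''-side is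
-- reached in this way.  So the arc P_e consists of the arrows whose heads lie on the e''-side, and
-- an edge f belongs to E_e exactly when its two arrows lie on different sides:
-- side f'' = side f' xor [f ∈ E_e].  As side is also constant along vertex circles, adding it
-- (mod 2) to a checkerboard colouring of G compensates exactly for reversing the arrows f' of the
-- edges f of E_e, and yields a checkerboard colouring of G^{τ(E_e)}.

module Submission where

open import Data.Bool using (Bool; true; false; not; _∧_; _xor_; if_then_else_)
import Data.Bool
open import Data.Bool.Properties
  using (not-involutive; not-¬; ¬-not; xor-identityʳ; xor-comm; xor-assoc; true-xor; not-distribˡ-xor)
open import Data.Empty using (⊥-elim)
open import Data.Fin as Fin using (Fin; zero; suc; toℕ)
open import Data.Fin.Properties using (pigeonhole; toℕ<n; toℕ-injective; toℕ-fromℕ<; combine-injective)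
open import Data.Nat using (ℕ; zero; suc; _+_; _∸_; _*_; _<_; _≤_; s≤s⁻¹)
open import Data.Nat.GeneralisedArithmetic using (fold; fold-+)
open import Data.Nat.Properties
  using (n<1+n; m+[n∸m]≡n; <⇒≤; m>n⇒m∸n≢0; +-suc; +-identityʳ; _<?_; n≮n; m<n⇒m<1+n; ≤∧≢⇒<;
         ≤-refl)
open import Data.Product using (∃; _×_; _,_; proj₁; proj₂)
open import Data.Sum using (_⊎_; inj₁; inj₂)
open import Data.Unit using (⊤; tt)
open import Function.Base using (_∘_)
open import Function.Bundles using (_↣_; Injection; mk↣; _⇔_; mk⇔; Equivalence)
import Function.Properties.Equivalence as Equiv
open import Relation.Binary.Construct.Closure.Equivalence using (EqClosure)
import Relation.Binary.Construct.Closure.Equivalence as EqClosure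
open import Relation.Binary.Construct.Closure.ReflexiveTransitive using (ε; _◅_; _◅◅_)
open import Relation.Binary.Construct.Closure.Symmetric using (fwd; bwd)
open import Relation.Binary.Definitions using (DecidableEquality)
open import Relation.Binary.PropositionalEquality
open import Relation.Nullary using (¬_; yes; no; does; contradiction)
open import Relation.Nullary.Decidable using (via-injection; _⊎-dec_; dec-true; dec-false)

open import Defs

data AltWalk {X : Set} (β α : X → X) (P : X → Set) : X → X → Set where
  []     : ∀ {x} → AltWalk β α P x x
  β-step : ∀ {x y} → AltWalk β α P (β x) y → AltWalk β α P x y
  α-step : ∀ {x y} → P x → AltWalk β α P (α x) y → AltWalk β α P x y

module _ {X : Set} {β α : X → X} {P : X → Set} where

  infixr 5 _++_
  _++_ : ∀ {x y z} → AltWalk β α P x y → AltWalk β α P y z → AltWalk β α P x z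
  []         ++ v = v
  β-step w   ++ v = β-step (w ++ v)
  α-step p w ++ v = α-step p (w ++ v)

  β-step-to : ∀ {x z y} → β x ≡ z → AltWalk β α P z y → AltWalk β α P x y
  β-step-to refl = β-step

  α-step-to : ∀ {x z y} → P x → α x ≡ z → AltWalk β α P z y → AltWalk β α P x y
  α-step-to p refl = α-step p

  reverse : (∀ x → β (β x) ≡ x) → (∀ x → α (α x) ≡ x) → (∀ {x} → P x → P (α x))
          → ∀ {x y} → AltWalk β α P x y → AltWalk β α P y x
  reverse β-invol α-invol P-α = go
    where
      go : ∀ {x y} → AltWalk β α P x y → AltWalk β α P y x
      go []               = []
      go (β-step {x} w)   = go w ++ β-step-to (β-invol x) []
      go (α-step {x} p w) = go w ++ α-step-to (P-α p) (α-invol x) []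

transfer : ∀ {X : Set} {β α α′ : X → X} {P P′ : X → Set} (I : X → Set)
         → (∀ {x} → I x → I (β x))
         → (∀ {x} → I x → P x → P′ x × α′ x ≡ α x × I (α x))
         → ∀ {x y} → I x → AltWalk β α P x y → AltWalk β α′ P′ x y
transfer I I-β I-α i []           = []
transfer I I-β I-α i (β-step w)   = β-step (transfer I I-β I-α (I-β i) w)
transfer I I-β I-α i (α-step p w) with I-α i p
... | p′ , α′≡α , i′ = α-step-to p′ α′≡α (transfer I I-β I-α i′ w)

AltWalk-map : ∀ {X : Set} {β α α′ : X → X} {P P′ : X → Set}
            → (∀ {x} → P x → P′ x × α′ x ≡ α x)
            → ∀ {x y} → AltWalk β α P x y → AltWalk β α′ P′ x y
AltWalk-map f = transfer (λ _ → ⊤) (λ _ → tt) (λ _ p → let p′ , eq = f p in p′ , eq , tt) tt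

expand : ∀ {X : Set} {β α α′ : X → X} {P Q : X → Set}
       → (∀ {x} → P x → AltWalk β α′ Q x (α x))
       → ∀ {x y} → AltWalk β α P x y → AltWalk β α′ Q x y
expand f []           = []
expand f (β-step w)   = β-step (expand f w)
expand f (α-step p w) = f p ++ expand f w

module BoundaryCycle {X : Set} {N : ℕ} (code : X ↣ Fin N) (β α : X → X)
  (β-invol : ∀ x → β (β x) ≡ x) (β-nofix : ∀ x → β x ≢ x)
  (α-invol : ∀ x → α (α x) ≡ x) (α-nofix : ∀ x → α x ≢ x) where

  open Injection code using (to; injective)

  _≟_ : DecidableEquality X
  _≟_ = via-injection code Fin._≟_

  φ : X → X
  φ x = α (β x)

  φ-injective : ∀ {x y} → φ x ≡ φ y → x ≡ y
  φ-injective {x} {y} eq = begin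
    x             ≡⟨ sym (β-invol x) ⟩
    β (β x)       ≡⟨ cong β (sym (α-invol (β x))) ⟩
    β (α (φ x))   ≡⟨ cong (β ∘ α) eq ⟩
    β (α (φ y))   ≡⟨ cong β (α-invol (β y)) ⟩
    β (β y)       ≡⟨ β-invol y ⟩
    y             ∎
    where open ≡-Reasoning

  orbit : X → ℕ → X
  orbit x n = fold x φ n

  orbit-cancel : ∀ n {x y} → orbit x n ≡ orbit y n → x ≡ y
  orbit-cancel zero    eq = eq
  orbit-cancel (suc n) eq = orbit-cancel n (φ-injective eq)

  orbit-shift : ∀ n x → orbit x (suc n) ≡ orbit (φ x) n
  orbit-shift zero    x = refl
  orbit-shift (suc n) x = cong φ (orbit-shift n x)

  -- Pigeonhole on the first N + 1 points of the orbit, then cancel the common prefix.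
  orbit-periodic : ∀ x → ∃ λ k → orbit x (suc k) ≡ x
  orbit-periodic x with pigeonhole (n<1+n N) (λ k → to (orbit x (toℕ k)))
  ... | i , j , i<j , same = period (toℕ j ∸ toℕ i) refl
    where
      returns : orbit x (toℕ j ∸ toℕ i) ≡ x
      returns = sym (orbit-cancel (toℕ i) (begin
        orbit x (toℕ i)                          ≡⟨ injective same ⟩
        orbit x (toℕ j)                          ≡⟨ cong (orbit x) (sym (m+[n∸m]≡n (<⇒≤ i<j))) ⟩
        orbit x (toℕ i + (toℕ j ∸ toℕ i))        ≡⟨ fold-+ x φ (toℕ i) ⟩
        orbit (orbit x (toℕ j ∸ toℕ i)) (toℕ i)  ∎))
        where open ≡-Reasoning
      period : ∀ d → d ≡ toℕ j ∸ toℕ i → ∃ λ k → orbit x (suc k) ≡ x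
      period zero    d≡ = ⊥-elim (m>n⇒m∸n≢0 i<j (sym d≡))
      period (suc k) d≡ = k , subst (λ d → orbit x d ≡ x) (sym d≡) returns

  -- β φ β is the inverse of φ, so a solution for n + 2 at x gives one for n at φ x.
  orbit-avoids-β : ∀ n x → orbit x n ≢ β x
  orbit-avoids-β zero          x eq = β-nofix x (sym eq)
  orbit-avoids-β (suc zero)    x eq = α-nofix (β x) eq
  orbit-avoids-β (suc (suc n)) x eq = orbit-avoids-β n (φ x) (begin
    orbit (φ x) n                ≡⟨ sym (orbit-shift n x) ⟩
    orbit x (suc n)              ≡⟨ sym (β-invol _) ⟩
    β (β (orbit x (suc n)))      ≡⟨ cong β (sym (α-invol _)) ⟩
    β (α (φ (orbit x (suc n))))  ≡⟨ cong (β ∘ α) eq ⟩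
    β (φ x)                      ∎)
    where open ≡-Reasoning

  Arc : X → X → Set
  Arc a z = z ≡ a ⊎ z ≡ α a

  OffArc : X → X → Set
  OffArc a z = ¬ Arc a z

  -- Go around the cycle through the arc a — α a, starting at α a; the first β-step back to a
  -- comes before any α-step on that arc (orbit-avoids-β excludes α a).
  bypass : ∀ a → AltWalk β α (OffArc a) (α a) a
  bypass a with orbit-periodic (α a)
  ... | k , back = search k 0 [] (trans (sym (α-invol _)) (trans (cong α back) (α-invol a)))
    where
      y : ℕ → X
      y = orbit (α a)
      search : ∀ n j → AltWalk β α (OffArc a) (α a) (y j) → β (y (j + n)) ≡ a
             → AltWalk β α (OffArc a) (α a) a
      search zero    j w hit = w ++ β-step-to (subst (λ i → β (y i) ≡ a) (+-identityʳ j) hit) []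
      search (suc n) j w hit with β (y j) ≟ a
      ... | yes βy≡a = w ++ β-step-to βy≡a []
      ... | no  βy≢a = search n (suc j) (w ++ β-step (α-step off []))
                                  (subst (λ i → β (y i) ≡ a) (+-suc j n) hit)
        where
          off : OffArc a (β (y j))
          off (inj₁ βy≡a)  = βy≢a βy≡a
          off (inj₂ βy≡αa) = orbit-avoids-β j (α a) (trans (sym (β-invol _)) (cong β βy≡αa))

  reach-arc : ∀ {Q : X → Set} a {x y} → AltWalk β α Q x y → Arc a y → AltWalk β α (OffArc a) x a
  reach-arc a []               (inj₁ refl) = []
  reach-arc a []               (inj₂ refl) = bypass a
  reach-arc a (β-step w)       end         = β-step (reach-arc a w end)
  reach-arc a (α-step {x} _ w) end with (x ≟ a) ⊎-dec (x ≟ α a)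
  ... | yes (inj₁ refl) = []
  ... | yes (inj₂ refl) = bypass a
  ... | no  off         = α-step off (reach-arc a w end)

flip2-involutive : ∀ i → flip2 (flip2 i) ≡ i
flip2-involutive zero       = refl
flip2-involutive (suc zero) = refl

≢⇒flip2 : ∀ {i j : Fin 2} → i ≢ j → i ≡ flip2 j
≢⇒flip2 {zero}     {zero}     i≢j = ⊥-elim (i≢j refl)
≢⇒flip2 {zero}     {suc zero} _   = refl
≢⇒flip2 {suc zero} {zero}     _   = refl
≢⇒flip2 {suc zero} {suc zero} i≢j = ⊥-elim (i≢j refl)

End↣Fin : ∀ {m} → End m ↣ Fin (m * (2 * 2))
End↣Fin = mk↣ injective
  where
    bit : Bool → Fin 2
    bit false = zero
    bit true  = suc zero
    code : ∀ {m} → End m → Fin (m * (2 * 2))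
    code (f , i , b) = Fin.combine f (Fin.combine i (bit b))
    bit-injective : ∀ {b c} → bit b ≡ bit c → b ≡ c
    bit-injective {false} {false} _ = refl
    bit-injective {true}  {true}  _ = refl
    injective : ∀ {m} {x y : End m} → code x ≡ code y → x ≡ y
    injective {x = f , i , b} {g , j , c} eq
      with refl , eq′ ← combine-injective f _ g _ eq
      with refl , eq″ ← combine-injective i _ j _ eq′
      with refl ← bit-injective eq″ = refl

-- The arc carrying an arrow of G^{δ(S)}, pulled back to the arrow ends of G along dualIn.
dualPartner : ∀ {m} → (Fin m → Bool) → End m → End m
dualPartner S (f , i , b) = f , (if S f then flip2 i else i) , not b

module _ {m} (S : Fin m → Bool) where

  dualPartner-in : ∀ {f i b} → S f ≡ true → dualPartner S (f , i , b) ≡ (f , flip2 i , not b)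
  dualPartner-in Sf rewrite Sf = refl

  dualPartner-out : ∀ {f i b} → S f ≡ false → dualPartner S (f , i , b) ≡ (f , i , not b)
  dualPartner-out Sf rewrite Sf = refl

  dualPartner-cong : ∀ S′ {f i b} → S f ≡ S′ f
                   → dualPartner S (f , i , b) ≡ dualPartner S′ (f , i , b)
  dualPartner-cong S′ Sf≡S′f rewrite Sf≡S′f = refl

  dualPartner-involutive : ∀ x → dualPartner S (dualPartner S x) ≡ x
  dualPartner-involutive (f , i , b) with S f
  ... | true  rewrite flip2-involutive i | not-involutive b = refl
  ... | false rewrite not-involutive b = refl

  dualPartner-nofix : ∀ x → dualPartner S x ≢ x
  dualPartner-nofix (f , i , b) eq = not-¬ refl (sym (cong (proj₂ ∘ proj₂) eq))

module _ {m} (A : Fin m → Bool) where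

  dualOut-fixes : ∀ {f i b} → A f ≡ false → dualOut A (f , i , b) ≡ (f , i , b)
  dualOut-fixes {f} Af with A f | Af
  ... | .false | refl = refl

  dualOut-dualPartner : ∀ x → dualOut A (dualPartner A x) ≡ arrowPartner (dualOut A x)
  dualOut-dualPartner (f , i , b) with A f
  dualOut-dualPartner (f , zero     , false) | true  = refl
  dualOut-dualPartner (f , zero     , true ) | true  = refl
  dualOut-dualPartner (f , suc zero , false) | true  = refl
  dualOut-dualPartner (f , suc zero , true ) | true  = refl
  ... | false = refl

  proj₁-dualOut : ∀ x → proj₁ (dualOut A x) ≡ proj₁ x
  proj₁-dualOut (f , i , b) with A f
  proj₁-dualOut (f , zero     , false) | true  = refl
  proj₁-dualOut (f , zero     , true ) | true  = refl
  proj₁-dualOut (f , suc zero , false) | true  = refl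
  proj₁-dualOut (f , suc zero , true ) | true  = refl
  ... | false = refl

  proj₁-dualIn : ∀ z → proj₁ (dualIn A z) ≡ proj₁ z
  proj₁-dualIn z = trans (sym (proj₁-dualOut (dualIn A z))) (cong proj₁ (dualOutIn A z))

  dualIn-fixes : ∀ {f i b} → A f ≡ false → dualIn A (f , i , b) ≡ (f , i , b)
  dualIn-fixes Af = trans (cong (dualIn A) (sym (dualOut-fixes Af))) (dualInOut A _)

  dualOut-head : ∀ {f} → A f ≡ true → dualOut A (f , suc zero , false) ≡ (f , zero , true)
  dualOut-head {f} Af with A f | Af
  ... | .true | refl = refl

  dualIn-head : ∀ {f} → A f ≡ true → dualIn A (f , zero , true) ≡ (f , suc zero , false)
  dualIn-head Af = trans (cong (dualIn A) (sym (dualOut-head Af))) (dualInOut A _)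

  dualIn-arrowPartner : ∀ z → dualIn A (arrowPartner z) ≡ dualPartner A (dualIn A z)
  dualIn-arrowPartner z = begin
    dualIn A (arrowPartner z)
      ≡⟨ cong (dualIn A ∘ arrowPartner) (sym (dualOutIn A z)) ⟩
    dualIn A (arrowPartner (dualOut A (dualIn A z)))
      ≡⟨ cong (dualIn A) (sym (dualOut-dualPartner (dualIn A z))) ⟩
    dualIn A (dualOut A (dualPartner A (dualIn A z)))
      ≡⟨ dualInOut A _ ⟩
    dualPartner A (dualIn A z)
      ∎
    where open ≡-Reasoning

_↾_ : ∀ {m} → (Fin m → Bool) → ℕ → Fin m → Bool
(S ↾ k) h = does (toℕ h <? k) ∧ S h

module _ {m} (S : Fin m → Bool) (h : Fin m) where

  ↾-sound : ∀ {k} → (S ↾ k) h ≡ true → toℕ h < k × S h ≡ true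
  ↾-sound {k} p with toℕ h <? k
  ... | yes h<k = h<k , trans (cong (_∧ S h) (sym (dec-true (toℕ h <? k) h<k))) p
  ... | no  h≮k = contradiction (trans (cong (_∧ S h) (sym (dec-false (toℕ h <? k) h≮k))) p) λ ()

  ↾-zero : (S ↾ 0) h ≡ false
  ↾-zero with toℕ h <? 0
  ... | no _ = refl

  ↾-full : (S ↾ m) h ≡ S h
  ↾-full rewrite dec-true (toℕ h <? m) (toℕ<n h) = refl

  ↾-at : (S ↾ toℕ h) h ≡ false
  ↾-at rewrite dec-false (toℕ h <? toℕ h) (n≮n (toℕ h)) = refl

  ↾-suc-at : (S ↾ suc (toℕ h)) h ≡ S h
  ↾-suc-at rewrite dec-true (toℕ h <? suc (toℕ h)) (n<1+n (toℕ h)) = refl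

  ↾-suc : ∀ {k} → toℕ h ≢ k → (S ↾ suc k) h ≡ (S ↾ k) h
  ↾-suc {k} h≢k with toℕ h <? k
  ... | yes h<k rewrite dec-true (toℕ h <? suc k) (m<n⇒m<1+n h<k) | dec-true (toℕ h <? k) h<k = refl
  ... | no  h≮k rewrite dec-false (toℕ h <? suc k) (λ h<1+k → h≮k (≤∧≢⇒< (s≤s⁻¹ h<1+k) h≢k))
                      | dec-false (toℕ h <? k) h≮k = refl

_∖_ : ∀ {m} → (Fin m → Bool) → Fin m → Fin m → Bool
(S ∖ f) h = not (does (h Fin.≟ f)) ∧ S h

module _ {m} (S : Fin m → Bool) (f : Fin m) where

  ∖-sound : ∀ {h} → (S ∖ f) h ≡ true → S h ≡ true × h ≢ f
  ∖-sound {h} p with h Fin.≟ f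
  ... | no h≢f = p , h≢f

  ∖-self : (S ∖ f) f ≡ false
  ∖-self rewrite dec-true (f Fin.≟ f) refl = refl

  ∖-other : ∀ {h} → h ≢ f → (S ∖ f) h ≡ S h
  ∖-other {h} h≢f rewrite dec-false (h Fin.≟ f) h≢f = refl

Acyclic : ∀ {m} → RibbonGraph m → (Fin m → Bool) → Set
Acyclic G S = ∀ f → S f ≡ true →
  ¬ Joined G (λ g → S g ≡ true × g ≢ f) (f , zero , true) (f , suc zero , true)

module DualCircles {m} (G : RibbonGraph m) where

  JoinedIn : (Fin m → Bool) → End m → End m → Set
  JoinedIn S = Joined G (λ h → S h ≡ true)

  step : ∀ {P : Fin m → Set} {x y} → SubStep G P x y → Joined G P x y
  step s = fwd s ◅ ε

  Joined-mono : ∀ {P Q : Fin m → Set} → (∀ {h} → P h → Q h)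
              → ∀ {x y} → Joined G P x y → Joined G Q x y
  Joined-mono P⊆Q = EqClosure.map λ where
    (viaGap x)    → viaGap x
    (viaArrow x)  → viaArrow x
    (viaEdge x p) → viaEdge x (P⊆Q p)

  to-head : ∀ {P : Fin m → Set} {h i} b → Joined G P (h , i , b) (h , i , true)
  to-head true  = ε
  to-head false = step (viaArrow _)

  dualPartner-joined : ∀ S x → JoinedIn S x (dualPartner S x)
  dualPartner-joined S (h , i , b) with S h in Sh
  ... | true  = step (viaEdge _ Sh) ◅◅ step (viaArrow _)
  ... | false = step (viaArrow _)

  Acyclic-mono : ∀ {S S′} → (∀ h → S′ h ≡ true → S h ≡ true) → Acyclic G S → Acyclic G S′
  Acyclic-mono S′⊆S acyclic f S′f =
    acyclic f (S′⊆S f S′f) ∘ Joined-mono λ (S′h , h≢f) → S′⊆S _ S′h , h≢f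

  DualWalk : (Fin m → Bool) → (End m → Set) → End m → End m → Set
  DualWalk S = AltWalk (gap G) (dualPartner S)

  Anywhere : End m → Set
  Anywhere _ = ⊤

  EndsOnOneCircle : (Fin m → Bool) → Fin m → Set
  EndsOnOneCircle S h = ∀ i b → DualWalk S Anywhere (h , i , b) (h , i , not b)

  AllEndsOnOneCircle : (Fin m → Bool) → Set
  AllEndsOnOneCircle S = ∀ h → S h ≡ true → EndsOnOneCircle S h

  EndsOnOneCircle-resp : ∀ {S S′ h} → (∀ f → S f ≡ S′ f)
                       → EndsOnOneCircle S h → EndsOnOneCircle S′ h
  EndsOnOneCircle-resp {S} {S′} S≗S′ circle i b =
    AltWalk-map (λ {(f , _ , _)} _ → tt , dualPartner-cong S′ S (sym (S≗S′ f))) (circle i b)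

  joined⇒dualWalk : ∀ {S} → AllEndsOnOneCircle S
                  → ∀ {x y} → JoinedIn S x y → DualWalk S Anywhere x y
  joined⇒dualWalk {S} circles = go
    where
      forward : ∀ {x y} → SubStep G (λ h → S h ≡ true) x y → DualWalk S Anywhere x y
      forward (viaGap x) = β-step []
      forward (viaArrow (h , i , b)) with S h in Sh
      ... | true  = circles h Sh i b
      ... | false = α-step-to tt (dualPartner-out S Sh) []
      forward (viaEdge (h , i , b) Sh) =
        α-step-to tt (dualPartner-in S Sh)
          (subst (λ c → DualWalk S Anywhere (h , flip2 i , not b) (h , flip2 i , c)) (not-involutive b)
                 (circles h Sh (flip2 i) (not b)))
      go : ∀ {x y} → JoinedIn S x y → DualWalk S Anywhere x y
      go ε           = []
      go (fwd s ◅ j) = forward s ++ go j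
      go (bwd s ◅ j) = reverse (gap-invol G) (dualPartner-involutive S) _ (forward s) ++ go j

  module AddEdge {S′ S : Fin m → Bool} {g : Fin m} (S′g : S′ g ≡ false) (Sg : S g ≡ true)
                 (agree : ∀ h → h ≢ g → S′ h ≡ S h)
                 (bridge : ¬ JoinedIn S′ (g , zero , true) (g , suc zero , true)) where

    open BoundaryCycle End↣Fin (gap G) (dualPartner S′)
                       (gap-invol G) (gap-nofix G) (dualPartner-involutive S′) (dualPartner-nofix S′)
      public using (Arc; OffArc; bypass; reach-arc)

    sides-apart : ∀ {i b c} → ¬ JoinedIn S′ (g , i , b) (g , flip2 i , c)
    sides-apart {zero}     {b} {c} J = bridge (EqClosure.symmetric _ (to-head b) ◅◅ J ◅◅ to-head c)
    sides-apart {suc zero} {b} {c} J =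
      bridge (EqClosure.symmetric _ (EqClosure.symmetric _ (to-head b) ◅◅ J ◅◅ to-head c))

    -- An S′-walk staying in the component of one side of g never meets the other side,
    -- so it avoids g altogether once the arc of g on its own side is avoided.
    escape : ∀ {j c b x y} → JoinedIn S′ (g , j , c) x
           → AltWalk (gap G) (dualPartner S′) (OffArc (g , j , b)) x y
           → DualWalk S (λ z → proj₁ z ≢ g) x y
    escape {j} {c} {b} = transfer (JoinedIn S′ (g , j , c)) (λ J → J ◅◅ step (viaGap _)) stays
      where
        on-arc : ∀ d → Arc (g , j , b) (g , j , d)
        on-arc d with d Data.Bool.≟ b
        ... | yes refl = inj₁ refl
        ... | no  d≢b  =
          inj₂ (trans (cong (λ d → g , j , d) (¬-not d≢b)) (sym (dualPartner-out S′ S′g)))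
        stays : ∀ {z} → JoinedIn S′ (g , j , c) z → OffArc (g , j , b) z
              → proj₁ z ≢ g × dualPartner S z ≡ dualPartner S′ z
                × JoinedIn S′ (g , j , c) (dualPartner S′ z)
        stays {h , i , d} J off with h Fin.≟ g
        ... | no h≢g = h≢g , dualPartner-cong S S′ (sym (agree h h≢g)) , J ◅◅ dualPartner-joined S′ _
        ... | yes refl with i Fin.≟ j
        ...   | yes refl = ⊥-elim (off (on-arc d))
        ...   | no  i≢j  =
          ⊥-elim (sides-apart (subst (λ k → JoinedIn S′ (g , j , c) (g , k , d)) (≢⇒flip2 i≢j) J))

    circle-g : EndsOnOneCircle S g
    circle-g i b =
      α-step-to tt (trans (dualPartner-in S Sg) (sym (dualPartner-out S′ S′g)))
        (AltWalk-map (λ _ → tt , refl) (escape (dualPartner-joined S′ a) (bypass a)))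
      ++ α-step-to tt (trans (dualPartner-in S Sg) (cong (λ k → g , k , not b) (flip2-involutive i))) []
      where
        a : End m
        a = g , flip2 i , b

    extend : AllEndsOnOneCircle S′ → AllEndsOnOneCircle S
    extend circles h Sh with h Fin.≟ g
    ... | yes refl = circle-g
    ... | no  h≢g  = λ i b → expand replace (circles h (trans (agree h h≢g) Sh) i b)
      where
        replace : ∀ {z} → ⊤ → DualWalk S Anywhere z (dualPartner S′ z)
        replace {h′ , i′ , c} _ with h′ Fin.≟ g
        ... | yes refl = subst (DualWalk S Anywhere _) (sym (dualPartner-out S′ S′g)) (circle-g i′ c)
        ... | no  h′≢g = α-step-to tt (dualPartner-cong S S′ (sym (agree h′ h′≢g))) []

  acyclic⇒ends-on-one-circle : ∀ {S} → Acyclic G S → AllEndsOnOneCircle S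
  acyclic⇒ends-on-one-circle {S} acyclic h Sh =
    EndsOnOneCircle-resp (↾-full S) (prefix m ≤-refl h (trans (↾-full S h) Sh))
    where
      grow : ∀ g {k} → toℕ g ≡ k → AllEndsOnOneCircle (S ↾ k) → AllEndsOnOneCircle (S ↾ suc k)
      grow g refl circles with S g in Sg
      ... | false = λ h p → EndsOnOneCircle-resp unchanged (circles h (trans (unchanged h) p))
        where
          unchanged : ∀ h → (S ↾ toℕ g) h ≡ (S ↾ suc (toℕ g)) h
          unchanged h with h Fin.≟ g
          ... | yes refl = trans (↾-at S g) (trans (sym Sg) (sym (↾-suc-at S g)))
          ... | no  h≢g  = sym (↾-suc S h (h≢g ∘ toℕ-injective))
      ... | true = AddEdge.extend (↾-at S g) (trans (↾-suc-at S g) Sg) agree bridge circles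
        where
          agree : ∀ h → h ≢ g → (S ↾ toℕ g) h ≡ (S ↾ suc (toℕ g)) h
          agree h h≢g = sym (↾-suc S h (h≢g ∘ toℕ-injective))
          bridge : ¬ JoinedIn (S ↾ toℕ g) (g , zero , true) (g , suc zero , true)
          bridge = acyclic g Sg ∘ Joined-mono λ p →
            let h<g , Sh = ↾-sound S _ {toℕ g} p in Sh , λ { refl → n≮n _ h<g }
      prefix : ∀ k → k ≤ m → AllEndsOnOneCircle (S ↾ k)
      prefix zero    _   h p = contradiction (trans (sym (↾-zero S h)) p) λ ()
      prefix (suc k) k<m = grow (Fin.fromℕ< k<m) (toℕ-fromℕ< k<m) (prefix k (<⇒≤ k<m))

≢⇒≡xor : ∀ {a b E : Bool} → (E ≡ true) ⇔ (a ≢ b) → b ≡ a xor E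
≢⇒≡xor {a} {b} {false} E⇔a≢b with a Data.Bool.≟ b
... | yes a≡b = trans (sym a≡b) (sym (xor-identityʳ a))
... | no  a≢b = contradiction (Equivalence.from E⇔a≢b a≢b) λ ()
≢⇒≡xor {a} {b} {true} E⇔a≢b =
  trans (¬-not (Equivalence.to E⇔a≢b refl ∘ sym)) (sym (trans (xor-comm a true) (true-xor a)))

partialPetrial-colourable : ∀ {m} (G : RibbonGraph m) (A : Fin m → Bool) (σ : End m → Bool)
  → (∀ x → σ (gap G x) ≡ σ x) → (∀ x → σ (arrowPartner x) ≡ σ x)
  → (∀ f b → σ (f , suc zero , b) ≡ σ (f , zero , b) xor A f)
  → CheckerboardColourable G → CheckerboardColourable (partialPetrial G A)
partialPetrial-colourable {m} G A σ σ-gap σ-arrow σ-across (c , c-gap , c-seg , c-edge) =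
  d ∘ petRelabel A , twisted-gap , twisted-seg , twisted-edge
  where
    d : End m → Bool
    d x = c x xor σ x

    c-arrow : ∀ f b → c (f , zero , not b) ≡ not (c (f , zero , b))
    c-arrow f true  = ¬-not (c-edge f ∘ sym)
    c-arrow f false = ¬-not (c-edge f)

    d-arrow : ∀ f b → d (f , zero , not b) ≡ not (d (f , zero , b))
    d-arrow f b = trans (cong₂ _xor_ (c-arrow f b) (σ-arrow (f , zero , b)))
                        (sym (not-distribˡ-xor (c (f , zero , b)) (σ (f , zero , b))))

    d-across : ∀ f b → d (f , suc zero , b) ≡ d (f , zero , b) xor A f
    d-across f b = trans (cong₂ _xor_ (c-seg (f , zero , b)) (σ-across f b))
                         (sym (xor-assoc (c (f , zero , b)) (σ (f , zero , b)) (A f)))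

    twisted-gap : ∀ x → d (petRelabel A (gap (partialPetrial G A) x)) ≡ d (petRelabel A x)
    twisted-gap x = trans (cong d (petRelabel-invol A _)) (cong₂ _xor_ (c-gap _) (σ-gap _))

    across : ∀ f b → d (f , suc zero , b) ≡ d (petRelabel A (f , zero , b))
    across f b with A f in Af
    ... | true  = trans (d-across f b) (trans (cong (d (f , zero , b) xor_) Af)
                    (trans (trans (xor-comm _ true) (true-xor _)) (sym (d-arrow f b))))
    ... | false = trans (d-across f b) (trans (cong (d (f , zero , b) xor_) Af) (xor-identityʳ _))

    twisted-seg : ∀ x → d (petRelabel A (segPartner x)) ≡ d (petRelabel A x)
    twisted-seg (f , zero     , b) = across f b
    twisted-seg (f , suc zero , b) = sym (across f b)

    twisted-edge : ∀ f → d (petRelabel A (f , zero , true)) ≢ d (petRelabel A (f , zero , false))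
    twisted-edge f with A f
    ... | true  = λ eq → not-¬ refl (trans (sym eq) (d-arrow f true))
    ... | false = λ eq → not-¬ refl (trans eq (d-arrow f true))

module SideOfCut {m} (G : RibbonGraph m) (T : Fin m → Bool) (tree : IsSpanningTree G T)
                 (e : Fin m) (Te : T e ≡ true) where

  open DualCircles G

  arrowIndex : Bool → Fin 2
  arrowIndex false = zero
  arrowIndex true  = suc zero

  -- s = false stands for the arrow e', s = true for e''.
  Side : End m → Bool → Set
  Side x s = JoinedIn (T ∖ e) x (e , arrowIndex s , true)

  e-bridge : ¬ JoinedIn (T ∖ e) (e , zero , true) (e , suc zero , true)
  e-bridge = proj₂ tree e Te ∘ Joined-mono (∖-sound T e)

  side-unique : ∀ {x s s′} → Side x s → Side x s′ → s ≡ s′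
  side-unique {s = false} {false} _ _ = refl
  side-unique {s = true}  {true}  _ _ = refl
  side-unique {s = false} {true}  p q = ⊥-elim (e-bridge (EqClosure.symmetric _ p ◅◅ q))
  side-unique {s = true}  {false} p q = ⊥-elim (e-bridge (EqClosure.symmetric _ q ◅◅ p))

  side-at-e : ∀ {x} → proj₁ x ≡ e → ∃ (Side x)
  side-at-e {_ , zero     , b} refl = false , to-head b
  side-at-e {_ , suc zero , b} refl = true  , to-head b

  restrict : ∀ {x y} → SubStep G (λ h → T h ≡ true) x y
           → SubStep G (λ h → (T ∖ e) h ≡ true) x y ⊎ (proj₁ x ≡ e × proj₁ y ≡ e)
  restrict (viaGap x)   = inj₁ (viaGap x)
  restrict (viaArrow x) = inj₁ (viaArrow x)
  restrict (viaEdge (h , i , b) Th) with h Fin.≟ e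
  ... | yes h≡e = inj₂ (h≡e , h≡e)
  ... | no  h≢e = inj₁ (viaEdge _ (trans (∖-other T e h≢e) Th))

  side-exists : ∀ x → ∃ (Side x)
  side-exists x = along (proj₁ tree (e , zero , true) x) (false , ε)
    where
      along : ∀ {y z} → JoinedIn T y z → ∃ (Side y) → ∃ (Side z)
      along ε side = side
      along (fwd st ◅ J) (s , side) with restrict st
      ... | inj₁ st′       = along J (s , bwd st′ ◅ side)
      ... | inj₂ (_ , z∈e) = along J (side-at-e z∈e)
      along (bwd st ◅ J) (s , side) with restrict st
      ... | inj₁ st′       = along J (s , fwd st′ ◅ side)
      ... | inj₂ (z∈e , _) = along J (side-at-e z∈e)

  side : End m → Bool
  side x = proj₁ (side-exists x)

  side-spec : ∀ x → Side x (side x)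
  side-spec x = proj₂ (side-exists x)

  side-resp : ∀ {x y} → JoinedIn (T ∖ e) x y → side x ≡ side y
  side-resp {x} {y} J = side-unique (side-spec x) (J ◅◅ side-spec y)

  side-e : ∀ s b → side (e , arrowIndex s , b) ≡ s
  side-e s b = side-unique (side-spec _) (to-head b)

  side-dualPartner : ∀ {x} → proj₁ x ≢ e → side (dualPartner T x) ≡ side x
  side-dualPartner {h , i , b} h≢e = sym (side-resp
    (subst (JoinedIn (T ∖ e) _) (dualPartner-cong (T ∖ e) T (∖-other T e h≢e))
           (dualPartner-joined (T ∖ e) _)))

  CutJoined : End m → End m → Set
  CutJoined = EqClosure (CutStep (partialDual G T) e)

  cut-step-preserves-side : ∀ {z z′} → CutStep (partialDual G T) e z z′
                          → side (dualIn T z) ≡ side (dualIn T z′)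
  cut-step-preserves-side (viaGap z) =
    trans (side-resp (step (viaGap _))) (cong side (sym (dualInOut T _)))
  cut-step-preserves-side (viaArrow z z≢e) =
    trans (sym (side-dualPartner (z≢e ∘ trans (sym (proj₁-dualIn T z)))))
          (cong side (sym (dualIn-arrowPartner T z)))

  cut-preserves-side : ∀ {z z′} → CutJoined z z′ → side (dualIn T z) ≡ side (dualIn T z′)
  cut-preserves-side ε           = refl
  cut-preserves-side (fwd s ◅ J) = trans (cut-step-preserves-side s) (cut-preserves-side J)
  cut-preserves-side (bwd s ◅ J) = trans (sym (cut-step-preserves-side s)) (cut-preserves-side J)

  walk⇒cutJoined : ∀ {x y} → DualWalk T (λ z → proj₁ z ≢ e) x y
                 → CutJoined (dualOut T x) (dualOut T y)
  walk⇒cutJoined []                 = ε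
  walk⇒cutJoined (β-step {x} w)     =
    fwd (viaGap _)
      ◅ subst (λ z → CutJoined (dualOut T (gap G z)) _) (sym (dualInOut T x)) (walk⇒cutJoined w)
  walk⇒cutJoined (α-step {x} x≢e w) =
    fwd (viaArrow _ (x≢e ∘ trans (sym (proj₁-dualOut T x))))
      ◅ subst (λ z → CutJoined z _) (dualOut-dualPartner T x) (walk⇒cutJoined w)

  far-side-walk : ∀ {x} → side x ≡ true
                → DualWalk T (λ z → proj₁ z ≢ e) x (e , suc zero , false)
  far-side-walk {x} sx = escape (EqClosure.symmetric _ to-e″) (reach-arc _ walk-to-e″ e″-on-arc)
    where
      open AddEdge {S′ = T ∖ e} {S = T} {g = e} (∖-self T e) Te (λ _ → ∖-other T e) e-bridge
      to-e″ : JoinedIn (T ∖ e) x (e , suc zero , true)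
      to-e″ = subst (Side x) sx (side-spec x)
      walk-to-e″ : DualWalk (T ∖ e) Anywhere x (e , suc zero , true)
      walk-to-e″ = joined⇒dualWalk
        (acyclic⇒ends-on-one-circle (Acyclic-mono (λ _ → proj₁ ∘ ∖-sound T e) (proj₂ tree))) to-e″
      e″-on-arc : Arc (e , suc zero , false) (e , suc zero , true)
      e″-on-arc = inj₂ (sym (dualPartner-out (T ∖ e) (∖-self T e)))

  onArc⇔side : ∀ {f i} → T f ≡ false → OnArc G T e f i ⇔ (side (f , i , true) ≡ true)
  onArc⇔side {f} {i} Tf = mk⇔
    (λ J → begin
      side (f , i , true)                ≡⟨ cong side (sym (dualIn-fixes T Tf)) ⟩
      side (dualIn T (f , i , true))     ≡⟨ cut-preserves-side J ⟩
      side (dualIn T (e , zero , true))  ≡⟨ cong side (dualIn-head T Te) ⟩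
      side (e , suc zero , false)        ≡⟨ side-e true false ⟩
      true                               ∎)
    (λ sf → subst₂ CutJoined (dualOut-fixes T Tf) (dualOut-head T Te)
                   (walk⇒cutJoined (far-side-walk sf)))
    where open ≡-Reasoning

  Separated : Fin m → Set
  Separated f = side (f , zero , true) ≢ side (f , suc zero , true)

  tree-edge-adjoint⇔separated : ∀ {f} → T f ≡ true → InAdjointSet G T e f ⇔ Separated f
  tree-edge-adjoint⇔separated {f} Tf = mk⇔ to from
    where
      to : InAdjointSet G T e f → Separated f
      to (inj₁ refl) same =
        contradiction (trans (sym (side-e false true)) (trans same (side-e true true))) λ ()
      to (inj₂ (Tf′ , _)) = contradiction (trans (sym Tf) Tf′) λ ()
      from : Separated f → InAdjointSet G T e f
      from sep with f Fin.≟ e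
      ... | yes f≡e = inj₁ f≡e
      ... | no  f≢e =
        ⊥-elim (sep (side-resp (step (viaEdge (f , zero , true) (trans (∖-other T e f≢e) Tf)))))

  cotree-edge-adjoint⇔separated : ∀ {f} → T f ≡ false → InAdjointSet G T e f ⇔ Separated f
  cotree-edge-adjoint⇔separated {f} Tf = mk⇔ to from
    where
      on⇒ : ∀ {i} → OnArc G T e f i → side (f , i , true) ≡ true
      on⇒ = Equivalence.to (onArc⇔side Tf)
      ⇒on : ∀ {i} → side (f , i , true) ≡ true → OnArc G T e f i
      ⇒on = Equivalence.from (onArc⇔side Tf)
      to : InAdjointSet G T e f → Separated f
      to (inj₁ refl)                          = contradiction (trans (sym Tf) Te) λ ()
      to (inj₂ (_ , inj₁ (on₀ , off₁))) same = off₁ (⇒on (trans (sym same) (on⇒ on₀)))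
      to (inj₂ (_ , inj₂ (off₀ , on₁))) same = off₀ (⇒on (trans same (on⇒ on₁)))
      from : Separated f → InAdjointSet G T e f
      from sep with side (f , zero , true) in s₀ | side (f , suc zero , true) in s₁
      ... | true  | false =
        inj₂ (Tf , inj₁ (⇒on s₀ , λ on₁ → contradiction (trans (sym (on⇒ on₁)) s₁) λ ()))
      ... | false | true  =
        inj₂ (Tf , inj₂ ((λ on₀ → contradiction (trans (sym (on⇒ on₀)) s₀) λ ()) , ⇒on s₁))
      ... | true  | true  = ⊥-elim (sep refl)
      ... | false | false = ⊥-elim (sep refl)

  adjoint⇔separated : ∀ f → InAdjointSet G T e f ⇔ Separated f
  adjoint⇔separated f with T f Data.Bool.≟ true
  ... | yes Tf = tree-edge-adjoint⇔separated Tf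
  ... | no  Tf = cotree-edge-adjoint⇔separated (¬-not Tf)

  side-gap : ∀ x → side (gap G x) ≡ side x
  side-gap x = sym (side-resp (step (viaGap x)))

  side-arrow : ∀ x → side (arrowPartner x) ≡ side x
  side-arrow x = sym (side-resp (step (viaArrow x)))

  side-across : (A : Fin m → Bool) → (∀ f → (A f ≡ true) ⇔ InAdjointSet G T e f)
              → ∀ f b → side (f , suc zero , b) ≡ side (f , zero , b) xor A f
  side-across A A⇔adjoint f b = begin
    side (f , suc zero , b)        ≡⟨ side-resp (to-head b) ⟩
    side (f , suc zero , true)     ≡⟨ ≢⇒≡xor (Equiv.trans (A⇔adjoint f) (adjoint⇔separated f)) ⟩
    side (f , zero , true) xor A f ≡⟨ cong (_xor A f) (sym (side-resp (to-head b))) ⟩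
    side (f , zero , b) xor A f    ∎
    where open ≡-Reasoning

lemma4p5 : ∀ {m : ℕ} (G : RibbonGraph m) (T : Fin m → Bool) → IsSpanningTree G T
         → (e : Fin m) → T e ≡ true
         → (Ee : Fin m → Bool) → (∀ f → (Ee f ≡ true) ⇔ InAdjointSet G T e f)
         → CheckerboardColourable G
         → CheckerboardColourable (partialPetrial G Ee)
lemma4p5 G T tree e Te Ee Ee⇔adjoint =
  partialPetrial-colourable G Ee side side-gap side-arrow (side-across Ee Ee⇔adjoint)
  where open SideOfCut G T tree e Te
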